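{- In the calculus $\mathrm{IS4C}^{\mathrm{Moggi,Cap}}$, for any context $\Gamma$, type $A$ and normal form $n:((c:\mathsf{Cap}),\blacksquare)\mathbin{+\!\!+}\Gamma\vdash_{nf}A$, there is a normal form $n':(\cdot,\blacksquare)\mathbin{+\!\!+}\Gamma\vdash_{nf}A$ such that $n=\oplus_{c:\mathsf{Cap}}\,n'$.
   Context: Types: $A,B::=\iota\mid A\Rightarrow B\mid\Box A\mid \mathsf{T}A\mid\mathsf{Cap}\mid\mathsf{String}\mid\mathsf{Unit}$. Contexts $\Gamma::=\cdot\mid\Gamma,A\mid\Gamma,\blacksquare$ (snoc lists; $\blacksquare$ a lock); $\Delta\mathbin{+\!\!+}\Gamma$ is concatenation; $(c:\mathsf{Cap})$ denotes the one-element context $\cdot,\mathsf{Cap}$. Variables: $\mathsf{zero}:(\Gamma,A)\vdash_{var}A$; $\mathsf{succ}\,v:(\Gamma,B)\vdash_{var}A$ for $v:\Gamma\vdash_{var}A$ (no variable passes a lock). The (IS4C) accessibility relation: $\mathsf{nil}:\Gamma\lhd\Gamma$; $\mathsf{ext}\,e:\Delta\lhd(\Gamma,A)$ and $\mathsf{lock}\,e:\Delta\lhd(\Gamma,\blacksquare)$ for $e:\Delta\lhd\Gamma$. Neutral elements $\Gamma\vdash_{ne}A$ and normal forms $\Gamma\vdash_{nf}A$ are defined mutually: $\mathsf{var}\,v:\Gamma\vdash_{ne}A$ for $v:\Gamma\vdash_{var}A$; $\mathsf{app}(n,m):\Gamma\vdash_{ne}B$ for $n:\Gamma\vdash_{ne}A\Rightarrow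 B$, $m:\Gamma\vdash_{nf}A$; $\mathsf{unbox}(n,e):\Gamma\vdash_{ne}A$ for $n:\Delta\vdash_{ne}\Box A$ and $e:\Delta\lhd\Gamma$; $\mathsf{up}\,n:\Gamma\vdash_{nf}X$ for $n:\Gamma\vdash_{ne}X$ and $X\in\{\iota,\mathsf{Cap},\mathsf{String}\}$; $\lambda n:\Gamma\vdash_{nf}A\Rightarrow B$ for $n:(\Gamma,A)\vdash_{nf}B$; $\mathsf{box}\,n:\Gamma\vdash_{nf}\Box A$ for $n:(\Gamma,\blacksquare)\vdash_{nf}A$; $\mathsf{return}\,m:\Gamma\vdash_{nf}\mathsf{T}A$ for $m:\Gamma\vdash_{nf}A$; $\mathsf{let}(n,m):\Gamma\vdash_{nf}\mathsf{T}B$ for $n:\Gamma\vdash_{ne}\mathsf{T}A$ and $m:(\Gamma,A)\vdash_{nf}\mathsf{T}B$; $\mathsf{unit}:\Gamma\vdash_{nf}\mathsf{Unit}$; $\mathsf{str}(s):\Gamma\vdash_{nf}\mathsf{String}$ for each string literal $s$; $\mathsf{let}(\mathsf{print}(c,s),m):\Gamma\vdash_{nf}\mathsf{T}A$ for $c:\Gamma\vdash_{nf}\mathsf{Cap}$, $s:\Gamma\vdash_{nf}\mathsf{String}$ and $m:(\Gamma,\mathsf{Unit})\vdash_{nf}\mathsf{T}A$. For a fixed context $\Theta$, $\oplus_\Theta$ maps a neutral/normal form in context $\Delta$ to one in context $\Theta\mathbin{+\!\!+}\Delta$ by structural recursion, keeping every constructor and every de Bruijn variable unchanged and replacing each accessibility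 proof $e:\Delta'\lhd\Delta''$ by the proof of $(\Theta\mathbin{+\!\!+}\Delta')\lhd(\Theta\mathbin{+\!\!+}\Delta'')$ built from the same constructors; $\oplus_{c:\mathsf{Cap}}$ is $\oplus_\Theta$ with $\Theta=(\cdot,\mathsf{Cap})$, applied to a normal form in context $(\cdot,\blacksquare)\mathbin{+\!\!+}\Gamma$ and yielding one in $((\cdot,\mathsf{Cap}),\blacksquare)\mathbin{+\!\!+}\Gamma$. -}

module Defs where

open import Data.String using (String)
open import Relation.Binary.PropositionalEquality using (_≡_; refl; cong; subst)

infixr 7 _⇒_
infixl 5 _,_ _,■

data Ty : Set where
  ι    : Ty
  _⇒_  : Ty → Ty → Ty
  □    : Ty → Ty
  T    : Ty → Ty
  Cap  : Ty
  Str  : Ty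
  Unit : Ty

data Ctx : Set where
  ·    : Ctx
  _,_  : Ctx → Ty → Ctx
  _,■  : Ctx → Ctx

infixl 6 _++_
_++_ : Ctx → Ctx → Ctx
Δ ++ ·       = Δ
Δ ++ (Γ , A) = (Δ ++ Γ) , A
Δ ++ (Γ ,■)  = (Δ ++ Γ) ,■

-- variables (no variable passes a lock)
data _⊢var_ : Ctx → Ty → Set where
  zero : ∀ {Γ A} → (Γ , A) ⊢var A
  succ : ∀ {Γ A B} → Γ ⊢var A → (Γ , B) ⊢var A

data _◁_ : Ctx → Ctx → Set where
  nil  : ∀ {Γ} → Γ ◁ Γ
  ext  : ∀ {Δ Γ A} → Δ ◁ Γ → Δ ◁ (Γ , A)
  lock : ∀ {Δ Γ} → Δ ◁ Γ → Δ ◁ (Γ ,■)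

data Base : Ty → Set where
  ι   : Base ι
  Cap : Base Cap
  Str : Base Str

mutual
  data _⊢ne_ : Ctx → Ty → Set where
    var   : ∀ {Γ A} → Γ ⊢var A → Γ ⊢ne A
    app   : ∀ {Γ A B} → Γ ⊢ne (A ⇒ B) → Γ ⊢nf A → Γ ⊢ne B
    unbox : ∀ {Γ Δ A} → Δ ⊢ne □ A → Δ ◁ Γ → Γ ⊢ne A

  data _⊢nf_ : Ctx → Ty → Set where
    up       : ∀ {Γ X} → Base X → Γ ⊢ne X → Γ ⊢nf X
    lam      : ∀ {Γ A B} → (Γ , A) ⊢nf B → Γ ⊢nf (A ⇒ B)
    box      : ∀ {Γ A} → (Γ ,■) ⊢nf A → Γ ⊢nf □ A
    return   : ∀ {Γ A} → Γ ⊢nf A → Γ ⊢nf T A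
    let'     : ∀ {Γ A B} → Γ ⊢ne T A → (Γ , A) ⊢nf T B → Γ ⊢nf T B
    unit     : ∀ {Γ} → Γ ⊢nf Unit
    str      : ∀ {Γ} → String → Γ ⊢nf Str
    letPrint : ∀ {Γ A} → Γ ⊢nf Cap → Γ ⊢nf Str → (Γ , Unit) ⊢nf T A → Γ ⊢nf T A

⊕var : ∀ Θ {Δ A} → Δ ⊢var A → (Θ ++ Δ) ⊢var A
⊕var Θ zero     = zero
⊕var Θ (succ v) = succ (⊕var Θ v)

⊕acc : ∀ Θ {Δ' Δ''} → Δ' ◁ Δ'' → (Θ ++ Δ') ◁ (Θ ++ Δ'')
⊕acc Θ nil      = nil
⊕acc Θ (ext e)  = ext (⊕acc Θ e)
⊕acc Θ (lock e) = lock (⊕acc Θ e)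

mutual
  ⊕ne : ∀ Θ {Δ A} → Δ ⊢ne A → (Θ ++ Δ) ⊢ne A
  ⊕ne Θ (var v)     = var (⊕var Θ v)
  ⊕ne Θ (app n m)   = app (⊕ne Θ n) (⊕nf Θ m)
  ⊕ne Θ (unbox n e) = unbox (⊕ne Θ n) (⊕acc Θ e)

  ⊕nf : ∀ Θ {Δ A} → Δ ⊢nf A → (Θ ++ Δ) ⊢nf A
  ⊕nf Θ (up b n)         = up b (⊕ne Θ n)
  ⊕nf Θ (lam n)          = lam (⊕nf Θ n)
  ⊕nf Θ (box n)          = box (⊕nf Θ n)
  ⊕nf Θ (return m)       = return (⊕nf Θ m)
  ⊕nf Θ (let' n m)       = let' (⊕ne Θ n) (⊕nf Θ m)
  ⊕nf Θ unit             = unit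
  ⊕nf Θ (str s)          = str s
  ⊕nf Θ (letPrint c s m) = letPrint (⊕nf Θ c) (⊕nf Θ s) (⊕nf Θ m)

++-assoc : ∀ Θ Δ Γ → Θ ++ (Δ ++ Γ) ≡ (Θ ++ Δ) ++ Γ
++-assoc Θ Δ ·       = refl
++-assoc Θ Δ (Γ , A) = cong (_, A) (++-assoc Θ Δ Γ)
++-assoc Θ Δ (Γ ,■)  = cong _,■ (++-assoc Θ Δ Γ)

cCap : Ctx
cCap = · , Cap

-- ⊕_{c:Cap} : ((·,■) ++ Γ ⊢nf A) → (((c:Cap),■) ++ Γ ⊢nf A)
-- (transported along the associativity of ++, since Θ ++ ((·,■) ++ Γ)
--  and (Θ ,■) ++ Γ are only propositionally equal for variable Γ)
⊕Cap : ∀ Γ {A} → ((· ,■) ++ Γ) ⊢nf A → ((cCap ,■) ++ Γ) ⊢nf A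
⊕Cap Γ {A} n = subst (_⊢nf A) (++-assoc cCap (· ,■) Γ) (⊕nf cCap n)

{-# OPTIONS --safe #-}
module Submission where

open import Defs
open import Data.Product using (Σ-syntax; proj₁; proj₂) renaming (_,_ to _⸴_)
open import Relation.Binary.PropositionalEquality
open ≡-Reasoning

-- In context Θ ,■ ++ Γ a variable cannot see Θ past the lock, so the only
-- way a normal form can mention Θ is an unbox whose accessibility proof crosses that lock.
-- The boxed neutral then lives in a prefix of Θ.  When Θ is lock-free and all its types
-- are base types, every neutral over a prefix of Θ has base type, never □ A; so no such
-- unbox exists and the normal form is a weakening by Θ, constructor by constructor.

data BaseCtx : Ctx → Set where
  ·   : BaseCtx ·
  _,_ : ∀ {Θ A} → BaseCtx Θ → Base A → BaseCtx (Θ , A)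

BaseCtx-◁ : ∀ {Δ Θ} → Δ ◁ Θ → BaseCtx Θ → BaseCtx Δ
BaseCtx-◁ nil     g       = g
BaseCtx-◁ (ext e) (g , _) = BaseCtx-◁ e g

var-Base : ∀ {Θ A} → BaseCtx Θ → Θ ⊢var A → Base A
var-Base (_ , b) zero     = b
var-Base (g , _) (succ v) = var-Base g v

ne-Base : ∀ {Θ A} → BaseCtx Θ → Θ ⊢ne A → Base A
ne-Base g (var v) = var-Base g v
ne-Base g (app n _) with ne-Base g n
... | ()
ne-Base g (unbox n e) with ne-Base (BaseCtx-◁ e g) n
... | ()

-- An accessibility proof into Θ ,■ ++ Γ either stays to the right of the lock, and is
-- then the image of one into ·,■ ++ Γ, or crosses it and starts from a prefix of Θ.
data ◁-View (Θ Γ : Ctx) : ∀ {Δ} → Δ ◁ (Θ ++ ((· ,■) ++ Γ)) → Set where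
  inside  : ∀ Γ' (e : ((· ,■) ++ Γ') ◁ ((· ,■) ++ Γ)) → ◁-View Θ Γ (⊕acc Θ e)
  outside : ∀ {Δ} (e : Δ ◁ (Θ ++ ((· ,■) ++ Γ))) → Δ ◁ Θ → ◁-View Θ Γ e

◁-view : ∀ Θ Γ {Δ} (e : Δ ◁ (Θ ++ ((· ,■) ++ Γ))) → ◁-View Θ Γ e
◁-view Θ · nil       = inside · nil
◁-view Θ · (lock e)  = outside (lock e) e
◁-view Θ (Γ , A) nil = inside (Γ , A) nil
◁-view Θ (Γ , A) (ext e) with ◁-view Θ Γ e
... | inside Γ' e'  = inside Γ' (ext e')
... | outside .e e' = outside (ext e) e'
◁-view Θ (Γ ,■) nil  = inside (Γ ,■) nil
◁-view Θ (Γ ,■) (lock e) with ◁-view Θ Γ e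
... | inside Γ' e'  = inside Γ' (lock e')
... | outside .e e' = outside (lock e) e'

⊕var-surjective : ∀ Θ Γ {A} (v : (Θ ++ ((· ,■) ++ Γ)) ⊢var A) →
                  Σ[ v' ∈ ((· ,■) ++ Γ) ⊢var A ] v ≡ ⊕var Θ v'
⊕var-surjective Θ (Γ , B) zero = zero ⸴ refl
⊕var-surjective Θ (Γ , B) (succ v) with ⊕var-surjective Θ Γ v
... | v' ⸴ refl = succ v' ⸴ refl

module _ {Θ : Ctx} (g : BaseCtx Θ) where

  mutual
    ⊕ne-surjective : ∀ Γ {A} (n : (Θ ++ ((· ,■) ++ Γ)) ⊢ne A) →
                     Σ[ n' ∈ ((· ,■) ++ Γ) ⊢ne A ] n ≡ ⊕ne Θ n'
    ⊕ne-surjective Γ (var v) with ⊕var-surjective Θ Γ v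
    ... | v' ⸴ refl = var v' ⸴ refl
    ⊕ne-surjective Γ (app n m) with ⊕ne-surjective Γ n | ⊕nf-surjective Γ m
    ... | n' ⸴ refl | m' ⸴ refl = app n' m' ⸴ refl
    ⊕ne-surjective Γ (unbox n e) with ◁-view Θ Γ e
    ... | outside .e e' with ne-Base (BaseCtx-◁ e' g) n
    ...   | ()
    ⊕ne-surjective Γ (unbox n e) | inside Γ' e' with ⊕ne-surjective Γ' n
    ...   | n' ⸴ refl = unbox n' e' ⸴ refl

    ⊕nf-surjective : ∀ Γ {A} (n : (Θ ++ ((· ,■) ++ Γ)) ⊢nf A) →
                     Σ[ n' ∈ ((· ,■) ++ Γ) ⊢nf A ] n ≡ ⊕nf Θ n'
    ⊕nf-surjective Γ (up b n) with ⊕ne-surjective Γ n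
    ... | n' ⸴ refl = up b n' ⸴ refl
    ⊕nf-surjective Γ (lam n) with ⊕nf-surjective (Γ , _) n
    ... | n' ⸴ refl = lam n' ⸴ refl
    ⊕nf-surjective Γ (box n) with ⊕nf-surjective (Γ ,■) n
    ... | n' ⸴ refl = box n' ⸴ refl
    ⊕nf-surjective Γ (return m) with ⊕nf-surjective Γ m
    ... | m' ⸴ refl = return m' ⸴ refl
    ⊕nf-surjective Γ (let' n m) with ⊕ne-surjective Γ n | ⊕nf-surjective (Γ , _) m
    ... | n' ⸴ refl | m' ⸴ refl = let' n' m' ⸴ refl
    ⊕nf-surjective Γ unit    = unit ⸴ refl
    ⊕nf-surjective Γ (str s) = str s ⸴ refl
    ⊕nf-surjective Γ (letPrint c s m)
      with ⊕nf-surjective Γ c | ⊕nf-surjective Γ s | ⊕nf-surjective (Γ , Unit) m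
    ... | c' ⸴ refl | s' ⸴ refl | m' ⸴ refl = letPrint c' s' m' ⸴ refl

lemma5p1 : (Γ : Ctx) (A : Ty) (n : ((cCap ,■) ++ Γ) ⊢nf A) →
    Σ[ n' ∈ ((· ,■) ++ Γ) ⊢nf A ] n ≡ ⊕Cap Γ n'
lemma5p1 Γ A n = n' ⸴ n≡⊕n'
  where
    p : cCap ++ ((· ,■) ++ Γ) ≡ (cCap ,■) ++ Γ
    p = ++-assoc cCap (· ,■) Γ

    weakening : Σ[ m ∈ ((· ,■) ++ Γ) ⊢nf A ] subst (_⊢nf A) (sym p) n ≡ ⊕nf cCap m
    weakening = ⊕nf-surjective (· , Cap) Γ (subst (_⊢nf A) (sym p) n)

    n' : ((· ,■) ++ Γ) ⊢nf A
    n' = proj₁ weakening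

    n≡⊕n' : n ≡ ⊕Cap Γ n'
    n≡⊕n' = begin
      n                                           ≡⟨ sym (subst-subst-sym p) ⟩
      subst (_⊢nf A) p (subst (_⊢nf A) (sym p) n) ≡⟨ cong (subst (_⊢nf A) p) (proj₂ weakening) ⟩
      subst (_⊢nf A) p (⊕nf cCap n')              ∎
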